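{- If $G$ is a finite simple graph without isolated vertices, then $Z(G)\leq Z(L(G))$, where $Z$ denotes the zero forcing number and $L(G)$ the line graph of $G$.
   Context: All graphs are non-empty, simple, finite and undirected; $[k]=\{1,\ldots,k\}$. The zero forcing number $Z(G)$ of a graph $G$ with $n$ vertices is the minimum positive integer $k$ for which there are $k$ vertices $u_1,\ldots,u_k$ of $G$ and a linear order $u_{k+1},\ldots,u_n$ of the remaining vertices such that for every $j\in\{k+1,\ldots,n\}$ there is some $i\in[j-1]$ such that $u_j$ is the unique neighbor of $u_i$ in $G$ contained in $\{u_j,u_{j+1},\ldots,u_n\}$ (one says $u_i$ forces $u_j$). The line graph $L(G)$ has vertex set $E(G)$, two vertices being adjacent iff the corresponding edges of $G$ share an endpoint. -}

module Defs where

open import Data.Nat using (ℕ; _≤_)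
open import Data.Fin using (Fin; toℕ) renaming (_<_ to _<ᶠ_)
open import Data.Bool using (Bool; true; false; T)
open import Data.List using (List; length; lookup)
open import Data.List.Membership.Propositional using (_∈_)
open import Data.List.Relation.Unary.Unique.Propositional using (Unique)
open import Data.Product using (Σ; ∃; ∃-syntax; _×_)
open import Data.Sum using (_⊎_)
open import Relation.Nullary using (¬_)
open import Relation.Binary.PropositionalEquality using (_≡_; _≢_)

record SimpleGraph (n : ℕ) : Set where
  field
    adj   : Fin n → Fin n → Bool
    sym   : ∀ u v → adj u v ≡ adj v u
    irrefl : ∀ v → adj v v ≡ false
open SimpleGraph public

NoIsolated : ∀ {n} → SimpleGraph n → Set
NoIsolated {n} G = ∀ (v : Fin n) → ∃[ u ] T (adj G v u)

record Graph : Set₁ where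
  field
    V   : Set
    Adj : V → V → Set
open Graph public

toGraph : ∀ {n} → SimpleGraph n → Graph
toGraph {n} G = record { V = Fin n ; Adj = λ u v → T (adj G u v) }

-- An edge {a, b} of G, represented canonically with a < b.
record Edge {n : ℕ} (G : SimpleGraph n) : Set where
  constructor edge
  field
    a   : Fin n
    b   : Fin n
    a<b : a <ᶠ b
    ab  : T (adj G a b)
open Edge public

ShareEnd : ∀ {n} {G : SimpleGraph n} → Edge G → Edge G → Set
ShareEnd e f = (a e ≡ a f ⊎ a e ≡ b f) ⊎ (b e ≡ a f ⊎ b e ≡ b f)

LineGraph : ∀ {n} → SimpleGraph n → Graph
LineGraph G = record { V = Edge G ; Adj = λ e f → e ≢ f × ShareEnd e f }

-- A zero forcing configuration of size k: a linear order u_1, ..., u_N of all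
-- vertices (a duplicate-free list containing every vertex), with 1 ≤ k ≤ N,
-- such that every vertex u_j with j > k (0-indexed: toℕ j ≥ k) is forced by
-- some earlier u_i, i.e. u_j is the unique neighbour of u_i among u_j,...,u_N.
record ZeroForcing (G : Graph) (k : ℕ) : Set where
  field
    order    : List (V G)
    unique   : Unique order
    complete : ∀ (v : V G) → v ∈ order
    k-pos    : 1 ≤ k
    k≤N      : k ≤ length order
    forces   : ∀ (j : Fin (length order)) → k ≤ toℕ j →
               ∃[ i ] (i <ᶠ j
                 × Adj G (lookup order i) (lookup order j)
                 × (∀ (m : Fin (length order)) → j <ᶠ m →
                      ¬ Adj G (lookup order i) (lookup order m)))

IsZeroForcingNumber : Graph → ℕ → Set
IsZeroForcingNumber G z = ZeroForcing G z × (∀ k → ZeroForcing G k → z ≤ k)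

-- Fix a zero forcing order e₀, …, e_{N-1} of L(G) whose first k edges are the
-- initial ones. When e_t (t ≥ k) is forced by e_i, call their common endpoint p
-- the pivot of step t. Merge the endpoints of the initial edges into classes and
-- make the root of each class its vertex that is earliest a pivot; there are at
-- most k non-roots, and they form a zero forcing set of G. Indeed, sweeping t
-- from k to N: if p is not yet reached, e_i is initial and its other end u, a
-- non-root, forces p; then p forces the other end of e_t, because every other
-- edge meeting e_i comes earlier in the order. A root that is never a pivot is
-- finally forced by any of its neighbours, all of which lie in its class or are
-- already reached. It suffices to show that the forcing closure of the non-roots
-- is everything: appending forceable vertices one at a time then gives a zero
-- forcing order of G.

module Submission where

open import Defs renaming (sym to adj-sym)
open import Data.Nat as ℕ using (ℕ; zero; suc; _+_; _≤_; _<_; z≤n; s≤s)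
import Data.Nat.Properties as NP
open import Data.Fin as F using (Fin; toℕ; fromℕ<)
import Data.Fin.Properties as FP
open import Data.Bool using (T)
open import Data.List using (List; []; _∷_; _∷ʳ_; length; lookup; tabulate; deduplicate)
open import Data.List.Membership.Propositional using (_∈_; _∉_)
open import Data.List.Membership.Propositional.Properties using (∈-lookup; ∈-++⁺ˡ; ∈-tabulate⁺; ∈-deduplicate⁺)
import Data.List.Properties as LP
open import Data.List.Relation.Unary.Any using (here; there; index)
open import Data.List.Relation.Unary.Any.Properties using (lookup-index)
import Data.List.Relation.Unary.All as All
open import Data.List.Relation.Unary.Unique.Propositional using (Unique)
open import Data.List.Relation.Unary.Unique.DecPropositional.Properties using (deduplicate-!)
open import Data.List.Relation.Unary.AllPairs using ([]; _∷_)
import Data.List.Relation.Unary.AllPairs.Properties as AllPairs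
open import Data.Maybe using (Maybe; just; nothing)
import Data.Maybe.Properties as MP
open import Data.Product using (Σ; ∃; _×_; _,_; proj₁; proj₂)
open import Function using (_∘_)
open import Data.Sum using (_⊎_; inj₁; inj₂)
open import Data.Empty using (⊥-elim)
open import Relation.Nullary using (¬_; Dec; yes; no)
open import Relation.Binary.Definitions using (tri<; tri≈; tri>)
open import Relation.Unary using (Decidable)
open import Relation.Nullary.Decidable using (_×-dec_; _→-dec_; ¬?; T?)
open import Relation.Binary.PropositionalEquality using (_≡_; _≢_; refl; sym; trans; cong; subst)

module _ {A : Set} where

  lookup-injective : ∀ {xs : List A} → Unique xs → ∀ {i j} → lookup xs i ≡ lookup xs j → i ≡ j
  lookup-injective {_ ∷ _} _         {F.zero}  {F.zero}  _  = refl
  lookup-injective {_ ∷ _} (x∉ ∷ _) {F.zero}  {F.suc j} eq = ⊥-elim (All.lookup x∉ (∈-lookup j) eq)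
  lookup-injective {_ ∷ _} (x∉ ∷ _) {F.suc i} {F.zero}  eq = ⊥-elim (All.lookup x∉ (∈-lookup i) (sym eq))
  lookup-injective {_ ∷ _} (_ ∷ xs!) {F.suc i} {F.suc j} eq = cong F.suc (lookup-injective xs! eq)

  length-∷ʳ : ∀ (xs : List A) v → length (xs ∷ʳ v) ≡ suc (length xs)
  length-∷ʳ xs v = trans (LP.length-++ xs) (NP.+-comm (length xs) 1)

  unique-∷ʳ : ∀ {xs : List A} {v} → Unique xs → v ∉ xs → Unique (xs ∷ʳ v)
  unique-∷ʳ xs! v∉ = AllPairs.++⁺ xs! (All.[] ∷ []) (All.tabulate λ x∈ → (λ { refl → v∉ x∈ }) All.∷ All.[])

  -- Natural-number positions survive appending at the end, unlike Fin indices.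
  at : List A → ℕ → Maybe A
  at []       _       = nothing
  at (x ∷ _)  zero    = just x
  at (_ ∷ xs) (suc p) = at xs p

  at-lookup : ∀ (xs : List A) (j : Fin (length xs)) → at xs (toℕ j) ≡ just (lookup xs j)
  at-lookup (_ ∷ _)  F.zero    = refl
  at-lookup (_ ∷ xs) (F.suc j) = at-lookup xs j

  at-< : ∀ (xs : List A) {p y} → at xs p ≡ just y → p < length xs
  at-< (_ ∷ _)  {zero}  _  = s≤s z≤n
  at-< (_ ∷ xs) {suc p} eq = s≤s (at-< xs eq)

  ∈⇒at : ∀ {xs : List A} {y} → y ∈ xs → ∃ λ p → at xs p ≡ just y
  ∈⇒at (here refl) = zero , refl
  ∈⇒at (there y∈) = let p , eq = ∈⇒at y∈ in suc p , eq

  at⇒∈ : ∀ {xs : List A} {p y} → at xs p ≡ just y → y ∈ xs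
  at⇒∈ {_ ∷ _}  {zero}  refl = here refl
  at⇒∈ {_ ∷ xs} {suc p} eq   = there (at⇒∈ {xs} eq)

  at-injective : ∀ {xs : List A} {p q y} → Unique xs → at xs p ≡ just y → at xs q ≡ just y → p ≡ q
  at-injective {_ ∷ _}  {zero}  {zero}  _         _    _    = refl
  at-injective {_ ∷ _}  {zero}  {suc q} (x∉ ∷ _) refl eq   = ⊥-elim (All.lookup x∉ (at⇒∈ eq) refl)
  at-injective {_ ∷ _}  {suc p} {zero}  (x∉ ∷ _) eq   refl = ⊥-elim (All.lookup x∉ (at⇒∈ eq) refl)
  at-injective {_ ∷ xs} {suc p} {suc q} (_ ∷ xs!) eq₁ eq₂ = cong suc (at-injective {xs} xs! eq₁ eq₂)

  at-∷ʳ⁺ : ∀ (xs : List A) {v p y} → at xs p ≡ just y → at (xs ∷ʳ v) p ≡ just y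
  at-∷ʳ⁺ (_ ∷ _)  {p = zero}  eq = eq
  at-∷ʳ⁺ (_ ∷ xs) {p = suc p} eq = at-∷ʳ⁺ xs eq

  at-∷ʳ⁻ : ∀ (xs : List A) v {p y} → at (xs ∷ʳ v) p ≡ just y → at xs p ≡ just y ⊎ (p ≡ length xs × y ≡ v)
  at-∷ʳ⁻ []       v {zero}  refl = inj₂ (refl , refl)
  at-∷ʳ⁻ (_ ∷ _)  v {zero}  eq   = inj₁ eq
  at-∷ʳ⁻ (_ ∷ xs) v {suc p} eq with at-∷ʳ⁻ xs v eq
  ... | inj₁ eq′           = inj₁ eq′
  ... | inj₂ (refl , y≡v) = inj₂ (refl , y≡v)

unique⇒length≤ : ∀ {n} {xs : List (Fin n)} → Unique xs → length xs ≤ n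
unique⇒length≤ {n} {xs} xs! with length xs ℕ.≤? n
... | yes ≤n = ≤n
... | no ≰n with FP.pigeonhole (NP.≰⇒> ≰n) (lookup xs)
...   | i , j , i<j , eq = ⊥-elim (NP.<⇒≢ i<j (cong toℕ (lookup-injective xs! eq)))

ForcingClosed : ∀ {n} → SimpleGraph n → (Fin n → Set) → Set
ForcingClosed {n} G P =
  ∀ u x → P u → T (adj G u x) → (∀ y → T (adj G u y) → y ≢ x → P y) → P x

ForcesAll : ∀ {n} → SimpleGraph n → List (Fin n) → Set₁
ForcesAll {n} G S = ∀ (P : Fin n → Set) → ForcingClosed G P → (∀ {x} → x ∈ S → P x) → ∀ x → P x

module Chronology {n : ℕ} (G : SimpleGraph n) (S : List (Fin n)) (S! : Unique S) (S-nonempty : 1 ≤ length S) where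
  open import Data.List.Membership.DecPropositional (F._≟_ {n}) using (_∈?_)

  Forceable : List (Fin n) → Fin n → Set
  Forceable ℓ v = v ∉ ℓ × ∃ λ u → u ∈ ℓ × T (adj G u v) × (∀ y → T (adj G u y) → y ≢ v → y ∈ ℓ)

  forceable? : ∀ ℓ → Dec (∃ (Forceable ℓ))
  forceable? ℓ = FP.any? λ v → ¬? (v ∈? ℓ) ×-dec FP.any? λ u → (u ∈? ℓ) ×-dec T? (adj G u v) ×-dec
                   FP.all? λ y → T? (adj G u y) →-dec (¬? (y F.≟ v) →-dec (y ∈? ℓ))

  data Chronological : List (Fin n) → Set where
    start  : Chronological S
    extend : ∀ {ℓ v} → Chronological ℓ → Forceable ℓ v → Chronological (ℓ ∷ʳ v)

  chronological-unique : ∀ {ℓ} → Chronological ℓ → Unique ℓ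
  chronological-unique start              = S!
  chronological-unique (extend c (v∉ , _)) = unique-∷ʳ (chronological-unique c) v∉

  chronological-length : ∀ {ℓ} → Chronological ℓ → length S ≤ length ℓ
  chronological-length start = NP.≤-refl
  chronological-length (extend {ℓ} {v} c _) rewrite length-∷ʳ ℓ v = NP.m≤n⇒m≤1+n (chronological-length c)

  chronological-⊇ : ∀ {ℓ} → Chronological ℓ → ∀ {x} → x ∈ S → x ∈ ℓ
  chronological-⊇ start        x∈ = x∈
  chronological-⊇ (extend c _) x∈ = ∈-++⁺ˡ (chronological-⊇ c x∈)

  ForcingOrder : List (Fin n) → Set
  ForcingOrder ℓ = ∀ j y → at ℓ j ≡ just y → length S ≤ j →
    ∃ λ i → i < j × ∃ λ u → at ℓ i ≡ just u × T (adj G u y) ×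
      (∀ z → T (adj G u z) → z ≢ y → ∃ λ q → q < j × at ℓ q ≡ just z)

  chronological-forcingOrder : ∀ {ℓ} → Chronological ℓ → ForcingOrder ℓ
  chronological-forcingOrder start j y eq S≤j = ⊥-elim (NP.<⇒≱ (at-< S eq) S≤j)
  chronological-forcingOrder (extend {ℓ} c (_ , u , u∈ , u~v , others∈)) j y eq S≤j
    with at-∷ʳ⁻ ℓ _ eq
  ... | inj₁ eq′ =
    let i , i<j , u′ , at-u′ , u′~y , others = chronological-forcingOrder c j y eq′ S≤j
    in  i , i<j , u′ , at-∷ʳ⁺ ℓ at-u′ , u′~y ,
        λ z u′~z z≢y → let q , q<j , at-z = others z u′~z z≢y in q , q<j , at-∷ʳ⁺ ℓ at-z
  ... | inj₂ (refl , refl) =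
    let i , at-u = ∈⇒at u∈
    in  i , at-< ℓ at-u , u , at-∷ʳ⁺ ℓ at-u , u~v ,
        λ z u~z z≢v → let q , at-z = ∈⇒at (others∈ z u~z z≢v) in q , at-< ℓ at-z , at-∷ʳ⁺ ℓ at-z

  grow : ℕ → Σ _ Chronological → Σ _ Chronological
  grow zero     c       = c
  grow (suc f) (ℓ , c) with forceable? ℓ
  ... | yes (v , v-forceable) = grow f (ℓ ∷ʳ v , extend c v-forceable)
  ... | no  _                 = ℓ , c

  grow-saturates-or-lengthens : ∀ f c →
    ¬ ∃ (Forceable (proj₁ (grow f c))) ⊎ length (proj₁ c) + f ≤ length (proj₁ (grow f c))
  grow-saturates-or-lengthens zero    (ℓ , _) = inj₂ (NP.≤-reflexive (NP.+-identityʳ (length ℓ)))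
  grow-saturates-or-lengthens (suc f) (ℓ , c) with forceable? ℓ
  ... | no  stuck = inj₁ stuck
  ... | yes (v , v-forceable) with grow-saturates-or-lengthens f (ℓ ∷ʳ v , extend c v-forceable)
  ...   | inj₁ stuck = inj₁ stuck
  ...   | inj₂ ≤len  = inj₂ (NP.≤-trans (NP.≤-reflexive (trans (NP.+-suc (length ℓ) f) (cong (_+ f) (sym (length-∷ʳ ℓ v))))) ≤len)

  saturated : List (Fin n)
  saturated = proj₁ (grow n (S , start))

  saturated-chronological : Chronological saturated
  saturated-chronological = proj₂ (grow n (S , start))

  -- n steps would produce a duplicate-free list of more than n vertices.
  saturated-stuck : ¬ ∃ (Forceable saturated)
  saturated-stuck with grow-saturates-or-lengthens n (S , start)
  ... | inj₁ stuck = stuck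
  ... | inj₂ ≤len  = ⊥-elim (NP.<⇒≱ (NP.≤-trans (NP.+-monoˡ-≤ n S-nonempty) ≤len)
                                    (unique⇒length≤ (chronological-unique saturated-chronological)))

  saturated-closed : ForcingClosed G (_∈ saturated)
  saturated-closed u x u∈ u~x others∈ with x ∈? saturated
  ... | yes x∈ = x∈
  ... | no  x∉ = ⊥-elim (saturated-stuck (x , x∉ , u , u∈ , u~x , others∈))

  saturated-unique : Unique saturated
  saturated-unique = chronological-unique saturated-chronological

  saturated-forces : ∀ (j : Fin (length saturated)) → length S ≤ toℕ j →
    ∃ λ i → i F.< j × T (adj G (lookup saturated i) (lookup saturated j))
          × (∀ m → j F.< m → ¬ T (adj G (lookup saturated i) (lookup saturated m)))
  saturated-forces j S≤j
    with i , i<j , u , at-u , u~y , others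
       ← chronological-forcingOrder saturated-chronological (toℕ j) _ (at-lookup saturated j) S≤j
    = i′ , subst (_< toℕ j) (sym toℕ-i′) i<j , subst (λ x → T (adj G x _)) (sym i′↦u) u~y , later
    where
    i<len = at-< saturated at-u
    i′ = fromℕ< i<len
    toℕ-i′ = FP.toℕ-fromℕ< i<len
    i′↦u : lookup saturated i′ ≡ u
    i′↦u = MP.just-injective (trans (sym (at-lookup saturated i′)) (trans (cong (at saturated) toℕ-i′) at-u))
    later : ∀ m → j F.< m → ¬ T (adj G (lookup saturated i′) (lookup saturated m))
    later m j<m u~m with lookup saturated m F.≟ lookup saturated j
    ... | yes eq = NP.<⇒≢ j<m (cong toℕ (lookup-injective saturated-unique (sym eq)))
    ... | no  ne with others _ (subst (λ x → T (adj G x _)) i′↦u u~m) ne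
    ...   | q , q<j , at-m = NP.<⇒≢ (NP.<-trans q<j j<m) (at-injective saturated-unique at-m (at-lookup saturated m))

forcesAll⇒zeroForcing : ∀ {n} (G : SimpleGraph n) (S : List (Fin n)) → Unique S → 1 ≤ length S →
                        ForcesAll G S → ZeroForcing (toGraph G) (length S)
forcesAll⇒zeroForcing G S S! S-nonempty forces-all = record
  { order    = saturated
  ; unique   = saturated-unique
  ; complete = forces-all (_∈ saturated) saturated-closed (chronological-⊇ saturated-chronological)
  ; k-pos    = S-nonempty
  ; k≤N      = chronological-length saturated-chronological
  ; forces   = saturated-forces
  }
  where open Chronology G S S! S-nonempty

firstIndex : ∀ {m} {P : Fin m → Set} → Decidable P → ℕ
firstIndex {zero}  P? = zero
firstIndex {suc m} P? with P? F.zero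
... | yes _ = zero
... | no  _ = suc (firstIndex (P? ∘ F.suc))

firstIndex-≤ : ∀ {m} {P : Fin m → Set} (P? : Decidable P) {t} → P t → firstIndex P? ≤ toℕ t
firstIndex-≤ {suc m} P? {t} Pt with P? F.zero
firstIndex-≤ {suc m} P? {t}       Pt | yes _ = z≤n
firstIndex-≤ {suc m} P? {F.zero}  Pt | no ¬P₀ = ⊥-elim (¬P₀ Pt)
firstIndex-≤ {suc m} P? {F.suc t} Pt | no _  = s≤s (firstIndex-≤ (P? ∘ F.suc) Pt)

firstIndex-found : ∀ {m} {P : Fin m → Set} (P? : Decidable P) →
                   firstIndex P? < m → ∃ λ t → toℕ t ≡ firstIndex P? × P t
firstIndex-found {suc m} P? fi<m with P? F.zero
... | yes P₀ = F.zero , refl , P₀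
... | no  _  = let t , t≡ , Pt = firstIndex-found (P? ∘ F.suc) (NP.≤-pred fi<m) in F.suc t , cong suc t≡ , Pt

module UnionFind {n : ℕ} (key : Fin n → ℕ) where

  relabel : Fin n × Fin n → Fin n → Fin n
  relabel (c , d) w with w F.≟ d
  ... | yes _ = c
  ... | no  _ = w

  relabel-↦winner : ∀ {c d w} → w ≡ c ⊎ w ≡ d → relabel (c , d) w ≡ c
  relabel-↦winner {c} {d} {w} w∈cd with w F.≟ d
  ... | yes _ = refl
  ... | no w≢d with w∈cd
  ...   | inj₁ w≡c = w≡c
  ...   | inj₂ w≡d = ⊥-elim (w≢d w≡d)

  relabel-key : ∀ {c d} → key c ≤ key d → ∀ w → key (relabel (c , d) w) ≤ key w
  relabel-key {c} {d} c≤d w with w F.≟ d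
  ... | yes refl = c≤d
  ... | no  _    = NP.≤-refl

  merge : Fin n × Fin n → (Fin n → Fin n) → Fin n × Fin n
  merge (x , y) r with key (r x) ℕ.≤? key (r y)
  ... | yes _ = r x , r y
  ... | no  _ = r y , r x

  merge-key : ∀ xy r → key (proj₁ (merge xy r)) ≤ key (proj₂ (merge xy r))
  merge-key (x , y) r with key (r x) ℕ.≤? key (r y)
  ... | yes ≤ = ≤
  ... | no  ≰ = NP.<⇒≤ (NP.≰⇒> ≰)

  merge-covers : ∀ x y r → let (c , d) = merge (x , y) r in
                 (r x ≡ c ⊎ r x ≡ d) × (r y ≡ c ⊎ r y ≡ d)
  merge-covers x y r with key (r x) ℕ.≤? key (r y)
  ... | yes _ = inj₁ refl , inj₂ refl
  ... | no  _ = inj₂ refl , inj₁ refl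

  rep : List (Fin n × Fin n) → Fin n → Fin n
  rep []       z = z
  rep (p ∷ ps) z = relabel (merge p (rep ps)) (rep ps z)

  losers : List (Fin n × Fin n) → List (Fin n)
  losers []       = []
  losers (p ∷ ps) = proj₂ (merge p (rep ps)) ∷ losers ps

  length-losers : ∀ ps → length (losers ps) ≡ length ps
  length-losers []       = refl
  length-losers (_ ∷ ps) = cong suc (length-losers ps)

  rep-joins : ∀ {x y ps} → (x , y) ∈ ps → rep ps x ≡ rep ps y
  rep-joins {x} {y} {_ ∷ ps} (here refl) =
    let x↦ , y↦ = merge-covers x y (rep ps) in trans (relabel-↦winner x↦) (sym (relabel-↦winner y↦))
  rep-joins {ps = p ∷ _} (there xy∈) = cong (relabel (merge p _)) (rep-joins xy∈)

  key-rep : ∀ ps z → key (rep ps z) ≤ key z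
  key-rep []       z = NP.≤-refl
  key-rep (p ∷ ps) z = NP.≤-trans (relabel-key (merge-key p (rep ps)) (rep ps z)) (key-rep ps z)

  nonroot∈losers : ∀ ps {z} → rep ps z ≢ z → z ∈ losers ps
  nonroot∈losers []       moved = ⊥-elim (moved refl)
  nonroot∈losers (p ∷ ps) {z} moved with rep ps z F.≟ proj₂ (merge p (rep ps)) | z F.≟ proj₂ (merge p (rep ps))
  ... | yes _    | yes z≡d = here z≡d
  ... | yes r≡d  | no  z≢d = there (nonroot∈losers ps (λ r≡z → z≢d (trans (sym r≡z) r≡d)))
  ... | no  _    | _       = there (nonroot∈losers ps moved)

module Edges {n : ℕ} (G : SimpleGraph n) where

  infix 4 _∈ₑ_
  _∈ₑ_ : Fin n → Edge G → Set
  x ∈ₑ e = x ≡ a e ⊎ x ≡ b e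

  adj⇒≢ : ∀ {u y} → T (adj G u y) → u ≢ y
  adj⇒≢ {u} u~u refl = subst T (irrefl G u) u~u

  a≢b : ∀ (e : Edge G) → a e ≢ b e
  a≢b e a≡b = NP.<-irrefl (cong toℕ a≡b) (a<b e)

  ends-adjacent : ∀ {x y} e → x ∈ₑ e → y ∈ₑ e → x ≢ y → T (adj G x y)
  ends-adjacent e (inj₁ refl) (inj₁ refl) x≢y = ⊥-elim (x≢y refl)
  ends-adjacent e (inj₁ refl) (inj₂ refl) _   = ab e
  ends-adjacent e (inj₂ refl) (inj₁ refl) _   = subst T (adj-sym G (a e) (b e)) (ab e)
  ends-adjacent e (inj₂ refl) (inj₂ refl) x≢y = ⊥-elim (x≢y refl)

  ends-are : ∀ {x y} e → x ∈ₑ e → y ∈ₑ e → x ≢ y → ∀ {z} → z ∈ₑ e → z ≡ x ⊎ z ≡ y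
  ends-are e (inj₁ refl) (inj₁ refl) x≢y _           = ⊥-elim (x≢y refl)
  ends-are e (inj₁ refl) (inj₂ refl) _   (inj₁ refl) = inj₁ refl
  ends-are e (inj₁ refl) (inj₂ refl) _   (inj₂ refl) = inj₂ refl
  ends-are e (inj₂ refl) (inj₁ refl) _   (inj₁ refl) = inj₂ refl
  ends-are e (inj₂ refl) (inj₁ refl) _   (inj₂ refl) = inj₁ refl
  ends-are e (inj₂ refl) (inj₂ refl) x≢y _           = ⊥-elim (x≢y refl)

  other-end : ∀ {p} e → p ∈ₑ e → Σ (Fin n) λ u → u ∈ₑ e × u ≢ p
  other-end e (inj₁ refl) = b e , inj₂ refl , a≢b e ∘ sym
  other-end e (inj₂ refl) = a e , inj₁ refl , a≢b e

  edge-through : ∀ {u y} → T (adj G u y) → Σ (Edge G) λ g → u ∈ₑ g × y ∈ₑ g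
  edge-through {u} {y} u~y with FP.<-cmp u y
  ... | tri< u<y _ _ = edge u y u<y u~y , inj₁ refl , inj₂ refl
  ... | tri≈ _ u≡y _ = ⊥-elim (adj⇒≢ u~y u≡y)
  ... | tri> _ _ y<u = edge y u y<u (subst T (adj-sym G u y) u~y) , inj₂ refl , inj₁ refl

  common-end⇒ShareEnd : ∀ {x} e f → x ∈ₑ e → x ∈ₑ f → ShareEnd e f
  common-end⇒ShareEnd e f (inj₁ refl) (inj₁ x≡) = inj₁ (inj₁ x≡)
  common-end⇒ShareEnd e f (inj₁ refl) (inj₂ x≡) = inj₁ (inj₂ x≡)
  common-end⇒ShareEnd e f (inj₂ refl) (inj₁ x≡) = inj₂ (inj₁ x≡)
  common-end⇒ShareEnd e f (inj₂ refl) (inj₂ x≡) = inj₂ (inj₂ x≡)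

  ShareEnd⇒common-end : ∀ e f → ShareEnd e f → Σ (Fin n) λ p → p ∈ₑ e × p ∈ₑ f
  ShareEnd⇒common-end e f (inj₁ (inj₁ a≡)) = a e , inj₁ refl , inj₁ a≡
  ShareEnd⇒common-end e f (inj₁ (inj₂ a≡)) = a e , inj₁ refl , inj₂ a≡
  ShareEnd⇒common-end e f (inj₂ (inj₁ b≡)) = b e , inj₂ refl , inj₁ b≡
  ShareEnd⇒common-end e f (inj₂ (inj₂ b≡)) = b e , inj₂ refl , inj₂ b≡

module LineGraphForcing {n : ℕ} (G : SimpleGraph n) (no-isolated : NoIsolated G)
                        {k : ℕ} (zf : ZeroForcing (LineGraph G) k) where
  open Edges G
  open ZeroForcing zf

  N : ℕ
  N = length order

  E : Fin N → Edge G
  E = lookup order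

  pos : Edge G → Fin N
  pos e = index (complete e)

  E-pos : ∀ e → E (pos e) ≡ e
  E-pos e = sym (lookup-index (complete e))

  pos-E : ∀ m → pos (E m) ≡ m
  pos-E m = lookup-injective unique (E-pos (E m))

  Initial : Edge G → Set
  Initial g = toℕ (pos g) < k

  forcer : ∀ t → k ≤ toℕ t → Fin N
  forcer t h = proj₁ (forces t h)

  forcer<t : ∀ t h → forcer t h F.< t
  forcer<t t h = proj₁ (proj₂ (forces t h))

  forcer-later : ∀ t h m → t F.< m → ¬ Adj (LineGraph G) (E (forcer t h)) (E m)
  forcer-later t h = proj₂ (proj₂ (proj₂ (forces t h)))

  pivot-ends : ∀ t h → Σ (Fin n) λ p → p ∈ₑ E (forcer t h) × p ∈ₑ E t
  pivot-ends t h = ShareEnd⇒common-end (E (forcer t h)) (E t) (proj₂ (proj₁ (proj₂ (proj₂ (forces t h)))))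

  pivot : ∀ t → k ≤ toℕ t → Fin n
  pivot t h = proj₁ (pivot-ends t h)

  PivotAt : Fin n → Fin N → Set
  PivotAt x t = Σ (k ≤ toℕ t) λ h → pivot t h ≡ x

  pivotAt? : ∀ x t → Dec (PivotAt x t)
  pivotAt? x t with k ℕ.≤? toℕ t
  ... | no  t≱k = no (t≱k ∘ proj₁)
  ... | yes h with pivot t h F.≟ x
  ...   | yes eq = yes (h , eq)
  ...   | no  ne = no λ (h′ , eq) → ne (trans (cong (pivot t) (NP.≤-irrelevant h h′)) eq)

  -- The first step at which x is the pivot, or N if there is none.
  key : Fin n → ℕ
  key x = firstIndex (pivotAt? x)

  k≤key : ∀ x → k ≤ key x
  k≤key x with key x ℕ.<? N
  ... | yes key<N = let t , t≡key , h , _ = firstIndex-found (pivotAt? x) key<N in subst (k ≤_) t≡key h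
  ... | no  key≮N = NP.≤-trans k≤N (NP.≮⇒≥ key≮N)

  key-pivot≤ : ∀ t h → key (pivot t h) ≤ toℕ t
  key-pivot≤ t h = firstIndex-≤ (pivotAt? (pivot t h)) (h , refl)

  key≡⇒pivot : ∀ x t h → key x ≡ toℕ t → x ≡ pivot t h
  key≡⇒pivot x t h key≡t with firstIndex-found (pivotAt? x) (subst (_< N) (sym key≡t) (FP.toℕ<n t))
  ... | t′ , t′≡key , h′ , pivot≡x with FP.toℕ-injective (trans t′≡key key≡t)
  ...   | refl = trans (sym pivot≡x) (cong (pivot t) (NP.≤-irrelevant h′ h))

  initial-pairs : List (Fin n × Fin n)
  initial-pairs = tabulate λ (j : Fin k) → let g = E (F.inject≤ j k≤N) in a g , b g

  open UnionFind key

  representative : Fin n → Fin n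
  representative = rep initial-pairs

  Root : Fin n → Set
  Root x = representative x ≡ x

  initial-joined : ∀ {g x y} → Initial g → x ∈ₑ g → y ∈ₑ g → representative x ≡ representative y
  initial-joined {g} g-initial x∈g y∈g = trans (to-a x∈g) (sym (to-a y∈g))
    where
    j = fromℕ< g-initial
    j↦g : E (F.inject≤ j k≤N) ≡ g
    j↦g = trans (cong E (FP.toℕ-injective (trans (FP.toℕ-inject≤ j k≤N) (FP.toℕ-fromℕ< g-initial)))) (E-pos g)
    ab-joined : representative (a g) ≡ representative (b g)
    ab-joined = rep-joins (subst (λ h → (a h , b h) ∈ initial-pairs) j↦g (∈-tabulate⁺ j))
    to-a : ∀ {z} → z ∈ₑ g → representative z ≡ representative (a g)
    to-a (inj₁ refl) = refl
    to-a (inj₂ refl) = sym ab-joined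

  roots-joined : ∀ {x y} → Root x → Root y → representative x ≡ representative y → x ≡ y
  roots-joined x-root y-root joined = trans (sym x-root) (trans joined y-root)

  -- Union by key makes the root of every class of minimal key within it.
  late-root-is-pivot : ∀ {y} t h → Root y → representative y ≡ representative (pivot t h) →
                       toℕ t ≤ key y → y ≡ pivot t h
  late-root-is-pivot {y} t h y-root joined t≤key = key≡⇒pivot y t h (NP.≤-antisym key≤t t≤key)
    where
    open NP.≤-Reasoning
    key≤t : key y ≤ toℕ t
    key≤t = begin
      key y                            ≡⟨ cong key (sym y-root) ⟩
      key (representative y)           ≡⟨ cong key joined ⟩
      key (representative (pivot t h)) ≤⟨ key-rep initial-pairs (pivot t h) ⟩
      key (pivot t h)                  ≤⟨ key-pivot≤ t h ⟩
      toℕ t                            ∎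

  S : List (Fin n)
  S = deduplicate F._≟_ (losers initial-pairs)

  S-unique : Unique S
  S-unique = deduplicate-! F._≟_ (losers initial-pairs)

  length-S≤k : length S ≤ k
  length-S≤k = begin
    length S                      ≤⟨ LP.length-deduplicate F._≟_ (losers initial-pairs) ⟩
    length (losers initial-pairs) ≡⟨ length-losers initial-pairs ⟩
    length initial-pairs          ≡⟨ LP.length-tabulate _ ⟩
    k                             ∎
    where open NP.≤-Reasoning

  S-nonempty : 1 ≤ length S
  S-nonempty with losers initial-pairs | length-losers initial-pairs
  ... | _ ∷ _ | _ = s≤s z≤n
  ... | []    | 0≡len = ⊥-elim (NP.<⇒≢ k-pos (trans 0≡len (LP.length-tabulate _)))

  nonroot∈S : ∀ {x} → ¬ Root x → x ∈ S
  nonroot∈S x-moved = ∈-deduplicate⁺ F._≟_ (nonroot∈losers initial-pairs x-moved)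

  module Sweep (P : Fin n → Set) (closed : ForcingClosed G P) (P⊇S : ∀ {x} → x ∈ S → P x) where

    Pending : ℕ → Edge G → Fin n → Set
    Pending t g x = Root x × t ≤ key x × Initial g

    SettledBefore : ℕ → Set
    SettledBefore t = ∀ g → toℕ (pos g) < t → ∀ {x} → x ∈ₑ g → P x ⊎ Pending t g x

    settled-initial : ∀ {t} → t ≤ k → SettledBefore t
    settled-initial {t} t≤k g g<t {x} _ with representative x F.≟ x
    ... | yes x-root = inj₂ (x-root , NP.≤-trans t≤k (k≤key x) , NP.<-≤-trans g<t t≤k)
    ... | no  x-moved = inj₁ (P⊇S (nonroot∈S x-moved))

    module Step (t : Fin N) (h : k ≤ toℕ t) (settled : SettledBefore (toℕ t)) where
      e f : Edge G
      e = E (forcer t h)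
      f = E t

      p : Fin n
      p = pivot t h

      p∈e : p ∈ₑ e
      p∈e = proj₁ (proj₂ (pivot-ends t h))

      p∈f : p ∈ₑ f
      p∈f = proj₂ (proj₂ (pivot-ends t h))

      e<t : toℕ (pos e) < toℕ t
      e<t = subst (λ i → toℕ i < toℕ t) (sym (pos-E (forcer t h))) (forcer<t t h)

      at-t⇒f : ∀ g → toℕ (pos g) ≡ toℕ t → g ≡ f
      at-t⇒f g g≡t = trans (sym (E-pos g)) (cong E (FP.toℕ-injective g≡t))

      before-t : ∀ g {x} → x ∈ₑ e → x ∈ₑ g → g ≢ f → toℕ (pos g) < toℕ t
      before-t g x∈e x∈g g≢f with NP.<-cmp (toℕ (pos g)) (toℕ t)
      ... | tri< g<t _ _ = g<t
      ... | tri≈ _ g≡t _ = ⊥-elim (g≢f (at-t⇒f g g≡t))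
      ... | tri> _ _ t<g = ⊥-elim (forcer-later t h (pos g) t<g (e≢g ∘ (λ e≡ → trans e≡ (E-pos g)) , e~g))
        where
        e≢g : e ≢ g
        e≢g refl = NP.<-asym e<t t<g
        e~g : ShareEnd e (E (pos g))
        e~g = common-end⇒ShareEnd e (E (pos g)) x∈e (subst (_ ∈ₑ_) (sym (E-pos g)) x∈g)

      joined-to-pivot⇒P : ∀ g {y z} → toℕ (pos g) < toℕ t → y ∈ₑ g → z ∈ₑ g →
                         representative z ≡ representative p → y ≢ p → P y
      joined-to-pivot⇒P g g<t y∈g z∈g z~p y≢p with settled g g<t y∈g
      ... | inj₁ Py = Py
      ... | inj₂ (y-root , t≤key , g-initial) =
        ⊥-elim (y≢p (late-root-is-pivot t h y-root (trans (initial-joined g-initial y∈g z∈g) z~p) t≤key))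

      -- If p is not known yet, e is initial, so its other end u is no root and
      -- forces p.
      P-p : P p
      P-p with settled e e<t p∈e
      ... | inj₁ Pp = Pp
      ... | inj₂ (_ , _ , e-initial) = closed u p P-u (ends-adjacent e u∈e p∈e u≢p) others
        where
        u = proj₁ (other-end e p∈e)
        u∈e = proj₁ (proj₂ (other-end e p∈e))
        u≢p = proj₂ (proj₂ (other-end e p∈e))
        u~p = initial-joined e-initial u∈e p∈e
        P-u : P u
        P-u = joined-to-pivot⇒P e e<t u∈e u∈e u~p u≢p
        others : ∀ y → T (adj G u y) → y ≢ p → P y
        others y u~y y≢p = joined-to-pivot⇒P g (before-t g u∈e u∈g g≢f) y∈g u∈g u~p y≢p
          where
          g = proj₁ (edge-through u~y)
          u∈g = proj₁ (proj₂ (edge-through u~y))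
          y∈g = proj₂ (proj₂ (edge-through u~y))
          g≢f : g ≢ f
          g≢f g≡f with ends-are g u∈g y∈g (adj⇒≢ u~y) (subst (p ∈ₑ_) (sym g≡f) p∈f)
          ... | inj₁ p≡u = u≢p (sym p≡u)
          ... | inj₂ p≡y = y≢p (sym p≡y)

      w : Fin n
      w = proj₁ (other-end f p∈f)

      w∈f : w ∈ₑ f
      w∈f = proj₁ (proj₂ (other-end f p∈f))

      w≢p : w ≢ p
      w≢p = proj₂ (proj₂ (other-end f p∈f))

      P-w : P w
      P-w = closed p w P-p (ends-adjacent f p∈f w∈f (w≢p ∘ sym)) others
        where
        others : ∀ y → T (adj G p y) → y ≢ w → P y
        others y p~y y≢w = joined-to-pivot⇒P g (before-t g p∈e p∈g g≢f) y∈g p∈g refl (adj⇒≢ p~y ∘ sym)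
          where
          g = proj₁ (edge-through p~y)
          p∈g = proj₁ (proj₂ (edge-through p~y))
          y∈g = proj₂ (proj₂ (edge-through p~y))
          g≢f : g ≢ f
          g≢f g≡f with ends-are g p∈g y∈g (adj⇒≢ p~y) (subst (w ∈ₑ_) (sym g≡f) w∈f)
          ... | inj₁ w≡p = w≢p w≡p
          ... | inj₂ w≡y = y≢w (sym w≡y)

      settled-next : SettledBefore (suc (toℕ t))
      settled-next g g≤t {x} x∈g with NP.m≤n⇒m<n∨m≡n (NP.≤-pred g≤t)
      ... | inj₁ g<t = advance (settled g g<t x∈g)
        where
        advance : P x ⊎ Pending (toℕ t) g x → P x ⊎ Pending (suc (toℕ t)) g x
        advance (inj₁ Px) = inj₁ Px
        advance (inj₂ (x-root , t≤key , g-initial)) with toℕ t ℕ.≟ key x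
        ... | yes t≡key = inj₁ (subst P (sym (key≡⇒pivot x t h (sym t≡key))) P-p)
        ... | no  t≢key = inj₂ (x-root , NP.≤∧≢⇒< t≤key t≢key , g-initial)
      ... | inj₂ g≡t with ends-are f p∈f w∈f (w≢p ∘ sym) (subst (x ∈ₑ_) (at-t⇒f g g≡t) x∈g)
      ...   | inj₁ refl = inj₁ P-p
      ...   | inj₂ refl = inj₁ P-w

    settled : ∀ t → t ≤ N → SettledBefore t
    settled t t≤N with t ℕ.≤? k
    settled t       t≤N | yes t≤k = settled-initial t≤k
    settled zero    t≤N | no  t≰k = ⊥-elim (t≰k z≤n)
    settled (suc t) t<N | no  t≰k =
      subst SettledBefore (cong suc toℕ-t′) (Step.settled-next t′ k≤t′ (subst SettledBefore (sym toℕ-t′) (settled t (NP.<⇒≤ t<N))))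
      where
      t′ = fromℕ< t<N
      toℕ-t′ = FP.toℕ-fromℕ< t<N
      k≤t′ : k ≤ toℕ t′
      k≤t′ = subst (k ≤_) (sym toℕ-t′) (NP.≤-pred (NP.≰⇒> t≰k))

    joined-to-root⇒P : ∀ g {x y z} → Root x → y ∈ₑ g → z ∈ₑ g →
                       representative z ≡ representative x → y ≢ x → P y
    joined-to-root⇒P g x-root y∈g z∈g z~x y≢x with settled N NP.≤-refl g (FP.toℕ<n (pos g)) y∈g
    ... | inj₁ Py = Py
    ... | inj₂ (y-root , _ , g-initial) =
      ⊥-elim (y≢x (roots-joined y-root x-root (trans (initial-joined g-initial y∈g z∈g) z~x)))

    -- A root x left pending is forced by any neighbour z, which lies in its class.
    P-everywhere : ∀ x → P x
    P-everywhere x with no-isolated x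
    ... | z , x~z with edge-through x~z
    ...   | g , x∈g , z∈g with settled N NP.≤-refl g (FP.toℕ<n (pos g)) x∈g
    ...     | inj₁ Px = Px
    ...     | inj₂ (x-root , _ , g-initial) = closed z x P-z (subst T (adj-sym G x z) x~z) others
      where
      P-z : P z
      P-z = joined-to-root⇒P g x-root z∈g x∈g refl (adj⇒≢ x~z ∘ sym)
      z~x = initial-joined g-initial z∈g x∈g
      others : ∀ y → T (adj G z y) → y ≢ x → P y
      others y z~y y≢x = joined-to-root⇒P g′ x-root y∈g′ z∈g′ z~x y≢x
        where
        g′ = proj₁ (edge-through z~y)
        z∈g′ = proj₁ (proj₂ (edge-through z~y))
        y∈g′ = proj₂ (proj₂ (edge-through z~y))

  S-forcesAll : ForcesAll G S
  S-forcesAll P closed P⊇S = Sweep.P-everywhere P closed P⊇S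

theorem2 : ∀ (n : ℕ) (G : SimpleGraph n) → 1 ≤ n → NoIsolated G →
    ∀ (z zL : ℕ) → IsZeroForcingNumber (toGraph G) z →
    IsZeroForcingNumber (LineGraph G) zL → z ≤ zL
theorem2 n G _ no-isolated z zL (_ , z-minimal) (zfL , _) =
  NP.≤-trans (z-minimal (length S) (forcesAll⇒zeroForcing G S S-unique S-nonempty S-forcesAll)) length-S≤k
  where open LineGraphForcing G no-isolated zfL
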